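{- If $G$ is a polyhedron, then $A(G)\neq\{1\}$.
   Context: All graphs are finite, simple and undirected. A polyhedron is a planar $3$-connected graph. $N(u,v)$ is the set of common neighbours of vertices $u,v$, and $A(G)=\{a : \exists \text{ distinct } u,v\in V(G),\ |N(u,v)|=a\}$. -}

module Defs where

open import Data.Nat using (ℕ; zero; suc; _+_; _*_; _<_; _≤ᵇ_; _<ᵇ_)
open import Data.Fin using (Fin; toℕ)
open import Data.Bool using (Bool; true; false; _∧_; if_then_else_)
open import Data.Product using (Σ; _×_; _,_; proj₁; proj₂)
open import Relation.Binary.PropositionalEquality using (_≡_; _≢_)

record Graph (n : ℕ) : Set where
  field
    adj    : Fin n → Fin n → Bool
    sym    : ∀ u v → adj u v ≡ adj v u
    irrefl : ∀ v → adj v v ≡ false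
open Graph public

count : ∀ {n} → (Fin n → Bool) → ℕ
count {zero}  p = 0
count {suc n} p = (if p Data.Fin.zero then 1 else 0) + count (λ i → p (Data.Fin.suc i))

sumFin : ∀ {n} → (Fin n → ℕ) → ℕ
sumFin {zero}  f = 0
sumFin {suc n} f = f Data.Fin.zero + sumFin (λ i → f (Data.Fin.suc i))

commonNbrs : ∀ {n} → Graph n → Fin n → Fin n → ℕ
commonNbrs G u v = count (λ w → adj G u w ∧ adj G v w)

InA : ∀ {n} → Graph n → ℕ → Set
InA {n} G a = Σ (Fin n) λ u → Σ (Fin n) λ v → u ≢ v × commonNbrs G u v ≡ a

-- Walks in G avoiding the removed vertex set X (X w ≡ true means w removed)
data Walk {n} (G : Graph n) (X : Fin n → Bool) : Fin n → Fin n → Set where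
  here : ∀ {u} → X u ≡ false → Walk G X u u
  step : ∀ {u w v} → X u ≡ false → adj G u w ≡ true → Walk G X w v → Walk G X u v

ConnectedWithout : ∀ {n} → Graph n → (Fin n → Bool) → Set
ConnectedWithout {n} G X =
  ∀ (u v : Fin n) → X u ≡ false → X v ≡ false → Walk G X u v

ThreeConnected : ∀ {n} → Graph n → Set
ThreeConnected {n} G = (3 < n) × (∀ (X : Fin n → Bool) → count X < 3 → ConnectedWithout G X)

iter : ∀ {A : Set} → (A → A) → ℕ → A → A
iter f zero    x = x
iter f (suc k) x = f (iter f k x)

-- Rotation system (combinatorial embedding): at each vertex v, rot v acts
-- as a cyclic permutation of the neighbourhood N(v).
record RotationSystem {n} (G : Graph n) : Set where
  field
    rot    : Fin n → Fin n → Fin n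
    closed : ∀ v u → adj G v u ≡ true → adj G v (rot v u) ≡ true
    cyclic : ∀ v u w → adj G v u ≡ true → adj G v w ≡ true →
             Σ ℕ λ k → iter (rot v) k u ≡ w
open RotationSystem public

module _ {n} {G : Graph n} (ρ : RotationSystem G) where
  Dart : Set
  Dart = Fin n × Fin n

  -- face-tracing permutation on darts: (u,v) ↦ (v, rot_v(u))
  faceStep : Dart → Dart
  faceStep (u , v) = (v , rot ρ v u)

  code : Dart → ℕ
  code (u , v) = toℕ u * n + toℕ v

  allBelow : ℕ → (ℕ → Bool) → Bool
  allBelow zero    p = true
  allBelow (suc k) p = p k ∧ allBelow k p

  -- d is the code-minimal dart of its face (orbit length ≤ n*n)
  isRep : Dart → Bool
  isRep d = allBelow (n * n) (λ k → code d ≤ᵇ code (iter faceStep k d))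

  -- number of faces = number of orbits of faceStep on the darts of G
  faces : ℕ
  faces = sumFin (λ u → count (λ v → adj G u v ∧ isRep (u , v)))

edges : ∀ {n} → Graph n → ℕ
edges G = sumFin (λ u → count (λ v → adj G u v ∧ (toℕ u <ᵇ toℕ v)))

-- Planarity of a connected graph: it has a combinatorial embedding of
-- genus 0, i.e. V − E + F = 2.
Planar : ∀ {n} → Graph n → Set
Planar {n} G = Σ (RotationSystem G) λ ρ → n + faces ρ ≡ edges G + 2

Polyhedron : ∀ {n} → Graph n → Set
Polyhedron G = ThreeConnected G × Planar G

AIsSingletonOne : ∀ {n} → Graph n → Set
AIsSingletonOne G = ∀ (a : ℕ) → (InA G a → a ≡ 1) × (a ≡ 1 → InA G a)

-- In a graph in which any two vertices have exactly one common neighbour, non-adjacent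
-- vertices u, v have the same degree: every neighbour of u starts exactly one walk of
-- length 3 to v, and walk counts are symmetric. If moreover every vertex has degree at
-- least 3 (as in a 3-connected graph), adjacent vertices u, v also have the same degree,
-- since a neighbour of their common neighbour outside {u, v} is adjacent to neither.
-- So the graph is (d + 1)-regular with A² = J + d·I and n = 1 + d(d + 1), and n > 3
-- forces d ≥ 2. For a prime p dividing d, A^(m+2) = (d + 1)^m J + d·A^m gives
-- tr A^p ≡ n ≡ 1 (mod p); but the closed walks of length p, read as lists of p vertices,
-- fall into rotation classes of exactly p elements.

module Submission where

open import Defs hiding (sym)
open import Data.Bool using (Bool; true; false; _∧_; _∨_; if_then_else_)
import Data.Bool as Bool
open import Data.Bool.Properties using (∧-assoc; ∧-comm; ∧-conicalˡ; ∧-conicalʳ; ∨-conicalˡ; ∨-conicalʳ)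
open import Data.Fin using (Fin; zero; suc; _≟_; toℕ; fromℕ<)
open import Data.Fin.Properties using (toℕ<n; toℕ-injective; toℕ-fromℕ<; all?)
open import Data.List using (List; []; _∷_; _++_; _∷ʳ_; [_]; length; allFin)
open import Data.List.Extrema.Nat using (argmin; f[argmin]≤f[xs])
open import Data.List.Membership.Propositional.Properties using (∈-allFin)
open import Data.List.Properties using (length-++; ++-assoc; ++-identityʳ; ∷-injectiveˡ)
open import Data.List.Relation.Unary.All as All using (_∷_)
open import Data.Nat using (ℕ; zero; suc; _+_; _*_; _^_; _∸_; _≤_; _<_; _≤?_; z≤n; s≤s; s≤s⁻¹; z<s;
                            NonZero; >-nonZero; >-nonZero⁻¹; nonTrivial⇒n>1)
open import Data.Nat.Properties hiding (_≟_)
open import Algebra.Properties.CommutativeSemigroup +-commutativeSemigroup using (interchange)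
open import Algebra.Properties.Semiring.Sum +-*-semiring
  using (sum-syntax; sum-cong-≗; sum-replicate-zero; ∑-comm; ∑-distrib-+; *-distribˡ-sum; *-distribʳ-sum)
open import Data.Nat.Coprimality using (Coprime; coprime-Bézout; prime⇒coprime)
open import Data.Nat.DivMod using (_%_; _/_; m≡m%n+[m/n]*n; m%n<n; [m+kn]%n≡m%n; m<n⇒m%n≡m; %-distribˡ-+; %-remove-+ʳ)
open import Data.Nat.Divisibility using (_∣_; divides; m∣m*n; ∣m⇒∣m*n; n∣m⇒m%n≡0)
open import Data.Nat.GCD using (module Bézout)
open import Data.Nat.ListAction using (product)
open import Data.Nat.Primality using (Prime; prime⇒nonZero; prime⇒nonTrivial)
open import Data.Nat.Primality.Factorisation using (factorise)
open import Data.Nat.Solver using (module +-*-Solver)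
open +-*-Solver using (solve; _:+_; _:*_; _:^_; _:=_; con)
open import Data.Empty using (⊥)
open import Data.Product using (∃-syntax; _×_; _,_; proj₁)
open import Function using (_∘_; id)
open import Function.Bundles using (mk⇔)
open import Relation.Binary.Definitions using (tri<; tri≈; tri>)
open import Relation.Binary.PropositionalEquality hiding ([_])
open import Relation.Nullary using (¬_; Dec; yes; no; does; contradiction; _×-dec_)
open import Relation.Nullary.Decidable using (dec-false; does-⇔)
open import Relation.Unary using (Decidable)

-- Finite sums and counting

𝟙 : Bool → ℕ
𝟙 b = if b then 1 else 0

𝟙-∧ : ∀ a b → 𝟙 (a ∧ b) ≡ 𝟙 a * 𝟙 b
𝟙-∧ true  b = sym (+-identityʳ (𝟙 b))
𝟙-∧ false b = refl

𝟙-idem : ∀ b → 𝟙 b * 𝟙 b ≡ 𝟙 b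
𝟙-idem true  = refl
𝟙-idem false = refl

δ : ∀ {n} → Fin n → Fin n → ℕ
δ u v = 𝟙 (does (u ≟ v))

δ-sym : ∀ {n} (u v : Fin n) → δ u v ≡ δ v u
δ-sym u v = cong 𝟙 (does-⇔ (mk⇔ sym sym) (u ≟ v) (v ≟ u))

dec-false⁻¹ : ∀ {A : Set} (a? : Dec A) → does a? ≡ false → ¬ A
dec-false⁻¹ (no ¬a) _ = ¬a

∑-const : ∀ {n} c → ∑[ i < n ] c ≡ n * c
∑-const {zero}  c = refl
∑-const {suc n} c = cong (c +_) (∑-const {n} c)

∑-δ : ∀ {n} (u : Fin n) (f : Fin n → ℕ) → ∑[ y < n ] (δ u y * f y) ≡ f u
∑-δ {suc n} zero    f = begin
  f zero + 0 + ∑[ y < n ] 0  ≡⟨ cong (f zero + 0 +_) (sum-replicate-zero n) ⟩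
  f zero + 0 + 0             ≡⟨ trans (+-identityʳ _) (+-identityʳ _) ⟩
  f zero                     ∎
  where open ≡-Reasoning
∑-δ {suc n} (suc u) f = ∑-δ u (f ∘ suc)

∑-𝟙-unique : ∀ {n} {Q : Fin n → Set} (Q? : Decidable Q) {x} → Q x → (∀ {y} → Q y → y ≡ x) →
             ∑[ y < n ] 𝟙 (does (Q? y)) ≡ 1
∑-𝟙-unique {n} {Q} Q? {x} Qx unique = trans (sum-cong-≗ 𝟙≡δ) (∑-δ x (λ _ → 1))
  where
  𝟙≡δ : ∀ y → 𝟙 (does (Q? y)) ≡ δ x y * 1
  𝟙≡δ y with Q? y | x ≟ y
  ... | yes _  | yes _    = refl
  ... | yes Qy | no x≢y   = contradiction (sym (unique Qy)) x≢y
  ... | no ¬Qy | yes refl = contradiction Qx ¬Qy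
  ... | no _   | no _     = refl

∑-𝟙-none : ∀ {n} {Q : Fin n → Set} (Q? : Decidable Q) → (∀ y → ¬ Q y) → ∑[ y < n ] 𝟙 (does (Q? y)) ≡ 0
∑-𝟙-none {n} Q? none = trans (sum-cong-≗ λ y → cong 𝟙 (dec-false (Q? y) (none y))) (sum-replicate-zero n)

∑-%-cong : ∀ {n p} .{{_ : NonZero p}} {f g : Fin n → ℕ} → (∀ i → f i % p ≡ g i % p) →
           (∑[ i < n ] f i) % p ≡ (∑[ i < n ] g i) % p
∑-%-cong {zero}              f≡g = refl
∑-%-cong {suc n} {p} {f} {g} f≡g = begin
  (f zero + ∑[ i < n ] f (suc i)) % p            ≡⟨ %-distribˡ-+ (f zero) _ p ⟩
  (f zero % p + (∑[ i < n ] f (suc i)) % p) % p  ≡⟨ cong₂ (λ a b → (a + b) % p) (f≡g zero) (∑-%-cong (f≡g ∘ suc)) ⟩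
  (g zero % p + (∑[ i < n ] g (suc i)) % p) % p  ≡⟨ %-distribˡ-+ (g zero) _ p ⟨
  (g zero + ∑[ i < n ] g (suc i)) % p            ∎
  where open ≡-Reasoning

count≡∑ : ∀ {n} (P : Fin n → Bool) → count P ≡ ∑[ i < n ] 𝟙 (P i)
count≡∑ {zero}  P = refl
count≡∑ {suc n} P = cong (𝟙 (P zero) +_) (count≡∑ (P ∘ suc))

count-≟ : ∀ {n} (u : Fin n) → count (λ i → does (i ≟ u)) ≡ 1
count-≟ u = trans (count≡∑ (λ i → does (i ≟ u))) (∑-𝟙-unique (_≟ u) refl id)

count-pos : ∀ {n} (P : Fin n → Bool) {x} → P x ≡ true → 0 < count P
count-pos P {zero}  Px rewrite Px = s≤s z≤n
count-pos P {suc x} Px = ≤-trans (count-pos (P ∘ suc) Px) (m≤n+m _ _)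

count>0⇒∃ : ∀ {n} (P : Fin n → Bool) → 0 < count P → ∃[ x ] P x ≡ true
count>0⇒∃ {suc n} P pos with P zero in Px
... | true  = zero , Px
... | false with count>0⇒∃ (P ∘ suc) pos
...   | x , Psx = suc x , Psx

count<n⇒∃false : ∀ {n} (P : Fin n → Bool) → count P < n → ∃[ x ] P x ≡ false
count<n⇒∃false {suc n} P lt with P zero in Px
... | false = zero , Px
... | true with count<n⇒∃false (P ∘ suc) (s≤s⁻¹ lt)
...   | x , Psx = suc x , Psx

count≤1⇒unique : ∀ {n} (P : Fin n → Bool) → count P ≤ 1 →
                 ∀ {x y} → P x ≡ true → P y ≡ true → x ≡ y
count≤1⇒unique P c≤1 {zero}  {zero}  Px Py = refl
count≤1⇒unique P c≤1 {zero}  {suc y} Px Py rewrite Px =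
  contradiction (s≤s⁻¹ c≤1) (<⇒≱ (count-pos (P ∘ suc) Py))
count≤1⇒unique P c≤1 {suc x} {zero}  Px Py rewrite Py =
  contradiction (s≤s⁻¹ c≤1) (<⇒≱ (count-pos (P ∘ suc) Px))
count≤1⇒unique P c≤1 {suc x} {suc y} Px Py =
  cong suc (count≤1⇒unique (P ∘ suc) (≤-trans (m≤n+m _ _) c≤1) Px Py)

count-∨ : ∀ {n} (P Q : Fin n → Bool) → count (λ i → P i ∨ Q i) ≤ count P + count Q
count-∨ {zero}  P Q = z≤n
count-∨ {suc n} P Q = begin
  𝟙 (P zero ∨ Q zero) + count (λ i → P (suc i) ∨ Q (suc i))
    ≤⟨ +-mono-≤ (𝟙-∨ (P zero) (Q zero)) (count-∨ (P ∘ suc) (Q ∘ suc)) ⟩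
  (𝟙 (P zero) + 𝟙 (Q zero)) + (count (P ∘ suc) + count (Q ∘ suc))
    ≡⟨ interchange (𝟙 (P zero)) _ _ _ ⟩
  count P + count Q ∎
  where
  open ≤-Reasoning
  𝟙-∨ : ∀ a b → 𝟙 (a ∨ b) ≤ 𝟙 a + 𝟙 b
  𝟙-∨ true  b = s≤s z≤n
  𝟙-∨ false b = ≤-refl

suc-^-% : ∀ {p d} .{{_ : NonZero p}} → p ∣ d → ∀ m → suc d ^ m % p ≡ 1 % p
suc-^-%         p∣d zero    = refl
suc-^-% {d = d} p∣d (suc m) = trans (%-remove-+ʳ (suc d ^ m) (∣m⇒∣m*n (suc d ^ m) p∣d)) (suc-^-% p∣d m)

∃-prime-divisor : ∀ {m} → 1 < m → ∃[ p ] Prime p × p ∣ m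
∃-prime-divisor {m} 1<m with factorise m {{>-nonZero (<-trans z<s 1<m)}}
... | record { factors = p ∷ ps ; isFactorisation = m≡Πps ; factorsPrime = p-prime ∷ _ } =
  p , p-prime , divides (product ps) (trans m≡Πps (*-comm p (product ps)))
... | record { factors = [] ; isFactorisation = m≡1 } = contradiction m≡1 (>⇒≢ 1<m)

3<1+d[1+d]⇒1<d : ∀ d → 3 < 1 + d * suc d → 1 < d
3<1+d[1+d]⇒1<d 0             (s≤s ())
3<1+d[1+d]⇒1<d 1             (s≤s (s≤s (s≤s ())))
3<1+d[1+d]⇒1<d (suc (suc d)) _ = s≤s (s≤s z≤n)

-- Rotations and necklaces

module _ {A : Set} (f : A → A) where

  iter-+ : ∀ m n x → iter f (m + n) x ≡ iter f m (iter f n x)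
  iter-+ zero    n x = refl
  iter-+ (suc m) n x = cong f (iter-+ m n x)

  iter-* : ∀ {d x} → iter f d x ≡ x → ∀ q → iter f (q * d) x ≡ x
  iter-*         fix zero    = refl
  iter-* {d} {x} fix (suc q) = trans (iter-+ d (q * d) x) (trans (cong (iter f d) (iter-* fix q)) fix)

  iter-% : ∀ {p x} .{{_ : NonZero p}} → iter f p x ≡ x → ∀ e → iter f e x ≡ iter f (e % p) x
  iter-% {p} {x} fix e = begin
    iter f e x                             ≡⟨ cong (λ e → iter f e x) (m≡m%n+[m/n]*n e p) ⟩
    iter f (e % p + e / p * p) x           ≡⟨ iter-+ (e % p) _ x ⟩
    iter f (e % p) (iter f (e / p * p) x)  ≡⟨ cong (iter f (e % p)) (iter-* fix (e / p)) ⟩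
    iter f (e % p) x                       ∎
    where open ≡-Reasoning

  iter-coprime : ∀ {p d x} → Coprime p d → iter f p x ≡ x → iter f d x ≡ x → f x ≡ x
  iter-coprime {p} {d} {x} coprime fixp fixd with coprime-Bézout coprime
  ... | Bézout.+- a b eq = begin
    f x                   ≡⟨ cong f (iter-* fixd b) ⟨
    iter f (1 + b * d) x  ≡⟨ cong (λ e → iter f e x) eq ⟩
    iter f (a * p) x      ≡⟨ iter-* fixp a ⟩
    x                     ∎
    where open ≡-Reasoning
  ... | Bézout.-+ a b eq = begin
    f x                   ≡⟨ cong f (iter-* fixp a) ⟨
    iter f (1 + a * p) x  ≡⟨ cong (λ e → iter f e x) eq ⟩
    iter f (b * d) x      ≡⟨ iter-* fixd b ⟩
    x                     ∎
    where open ≡-Reasoning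

rotate : ∀ {A : Set} → List A → List A
rotate []       = []
rotate (x ∷ xs) = xs ∷ʳ x

module _ {A : Set} where

  length-rotate : ∀ (s : List A) → length (rotate s) ≡ length s
  length-rotate []       = refl
  length-rotate (x ∷ xs) = trans (length-++ xs) (+-comm (length xs) 1)

  length-iter-rotate : ∀ e (s : List A) → length (iter rotate e s) ≡ length s
  length-iter-rotate zero    s = refl
  length-iter-rotate (suc e) s = trans (length-rotate (iter rotate e s)) (length-iter-rotate e s)

  iter-rotate-++ : ∀ (xs ys : List A) → iter rotate (length xs) (xs ++ ys) ≡ ys ++ xs
  iter-rotate-++ []       ys = sym (++-identityʳ ys)
  iter-rotate-++ (x ∷ xs) ys = begin
    iter rotate (suc (length xs)) (x ∷ xs ++ ys)  ≡⟨ cong (λ e → iter rotate e (x ∷ xs ++ ys)) (+-comm 1 (length xs)) ⟩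
    iter rotate (length xs + 1) (x ∷ xs ++ ys)    ≡⟨ iter-+ rotate (length xs) 1 _ ⟩
    iter rotate (length xs) ((xs ++ ys) ∷ʳ x)     ≡⟨ cong (iter rotate (length xs)) (++-assoc xs ys [ x ]) ⟩
    iter rotate (length xs) (xs ++ (ys ∷ʳ x))     ≡⟨ iter-rotate-++ xs (ys ∷ʳ x) ⟩
    (ys ∷ʳ x) ++ xs                               ≡⟨ ++-assoc ys [ x ] xs ⟩
    ys ++ x ∷ xs                                  ∎
    where open ≡-Reasoning

  iter-rotate-length : ∀ (s : List A) → iter rotate (length s) s ≡ s
  iter-rotate-length s = trans (cong (iter rotate (length s)) (sym (++-identityʳ s))) (iter-rotate-++ s [])

sumLists : ∀ {n} → ℕ → (List (Fin n) → ℕ) → ℕ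
sumLists         zero    f = f []
sumLists {n = n} (suc ℓ) f = ∑[ x < n ] sumLists ℓ (λ xs → f (x ∷ xs))

module _ {n : ℕ} where

  sumLists-cong : ∀ ℓ {f g : List (Fin n) → ℕ} → (∀ xs → length xs ≡ ℓ → f xs ≡ g xs) →
                  sumLists ℓ f ≡ sumLists ℓ g
  sumLists-cong zero    f≗g = f≗g [] refl
  sumLists-cong (suc ℓ) f≗g = sum-cong-≗ λ x → sumLists-cong ℓ λ xs len → f≗g (x ∷ xs) (cong suc len)

  sumLists-*ˡ : ∀ ℓ c (f : List (Fin n) → ℕ) → sumLists ℓ (λ xs → c * f xs) ≡ c * sumLists ℓ f
  sumLists-*ˡ zero    c f = refl
  sumLists-*ˡ (suc ℓ) c f = trans (sum-cong-≗ λ x → sumLists-*ˡ ℓ c (λ xs → f (x ∷ xs)))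
                                  (sym (*-distribˡ-sum c (λ x → sumLists ℓ (λ xs → f (x ∷ xs)))))

  ∑-sumLists-comm : ∀ {m} ℓ (f : Fin m → List (Fin n) → ℕ) →
                    ∑[ i < m ] sumLists ℓ (f i) ≡ sumLists ℓ (λ xs → ∑[ i < m ] f i xs)
  ∑-sumLists-comm zero    f = refl
  ∑-sumLists-comm (suc ℓ) f = trans (∑-comm (λ i x → sumLists ℓ (λ xs → f i (x ∷ xs))))
                                    (sum-cong-≗ λ x → ∑-sumLists-comm ℓ (λ i xs → f i (x ∷ xs)))

  sumLists-∷ʳ : ∀ ℓ (f : List (Fin n) → ℕ) →
                sumLists (suc ℓ) f ≡ sumLists ℓ (λ xs → ∑[ x < n ] f (xs ∷ʳ x))
  sumLists-∷ʳ zero    f = refl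
  sumLists-∷ʳ (suc ℓ) f = sum-cong-≗ λ y → sumLists-∷ʳ ℓ (λ xs → f (y ∷ xs))

  sumLists-rotate : ∀ ℓ (f : List (Fin n) → ℕ) → sumLists ℓ (f ∘ rotate) ≡ sumLists ℓ f
  sumLists-rotate zero    f = refl
  sumLists-rotate (suc ℓ) f = trans (∑-sumLists-comm ℓ (λ x xs → f (xs ∷ʳ x))) (sym (sumLists-∷ʳ ℓ f))

  sumLists-iter-rotate : ∀ ℓ e (f : List (Fin n) → ℕ) → sumLists ℓ (f ∘ iter rotate e) ≡ sumLists ℓ f
  sumLists-iter-rotate ℓ zero    f = refl
  sumLists-iter-rotate ℓ (suc e) f = trans (sumLists-iter-rotate ℓ e (f ∘ rotate)) (sumLists-rotate ℓ f)

encode : ∀ {n} → List (Fin n) → ℕ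
encode         []       = 0
encode {n = n} (x ∷ xs) = toℕ x + encode xs * n

encode-injective : ∀ {n} {xs ys : List (Fin n)} → length xs ≡ length ys → encode xs ≡ encode ys → xs ≡ ys
encode-injective {xs = []}     {[]}     _   _  = refl
encode-injective {n = suc n} {x ∷ xs} {y ∷ ys} len eq =
  cong₂ _∷_ (toℕ-injective x≡y) (encode-injective (suc-injective len) (*-cancelʳ-≡ _ _ (suc n) tail≡))
  where
  digit : ∀ (z : Fin (suc n)) k → (toℕ z + k * suc n) % suc n ≡ toℕ z
  digit z k = trans ([m+kn]%n≡m%n (toℕ z) k (suc n)) (m<n⇒m%n≡m (toℕ<n z))
  x≡y : toℕ x ≡ toℕ y
  x≡y = trans (sym (digit x (encode xs))) (trans (cong (_% suc n) eq) (digit y (encode ys)))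
  tail≡ : encode xs * suc n ≡ encode ys * suc n
  tail≡ = +-cancelˡ-≡ (toℕ x) _ _ (trans eq (cong (_+ encode ys * suc n) (sym x≡y)))

-- Since p is prime, the rotations of a list satisfying C are pairwise distinct, and each
-- rotation class is counted once through its member of least encode.
module Necklace {n p : ℕ} (p-prime : Prime p) (C : List (Fin n) → Bool)
                (C-rotate : ∀ s → C (rotate s) ≡ C s)
                (C-aperiodic : ∀ s → length s ≡ p → C s ≡ true → rotate s ≢ s) where

  private instance
    p≢0 : NonZero p
    p≢0 = prime⇒nonZero p-prime

  rotation : List (Fin n) → Fin p → List (Fin n)
  rotation s i = iter rotate (toℕ i) s

  C-iter-rotate : ∀ e s → C (iter rotate e s) ≡ C s
  C-iter-rotate zero    s = refl
  C-iter-rotate (suc e) s = trans (C-rotate (iter rotate e s)) (C-iter-rotate e s)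

  iter-rotate-p : ∀ {s : List (Fin n)} → length s ≡ p → iter rotate p s ≡ s
  iter-rotate-p {s} len = subst (λ e → iter rotate e s ≡ s) len (iter-rotate-length s)

  no-proper-period : ∀ {s d} → length s ≡ p → C s ≡ true → 0 < d → d < p → iter rotate d s ≢ s
  no-proper-period {s} len Cs 0<d d<p fix = C-aperiodic s len Cs
    (iter-coprime rotate (prime⇒coprime p-prime {{>-nonZero 0<d}} d<p) (iter-rotate-p len) fix)

  IsRepresentative : List (Fin n) → Set
  IsRepresentative t = C t ≡ true × (∀ j → encode t ≤ encode (rotation t j))

  isRepresentative? : Decidable IsRepresentative
  isRepresentative? t = (C t Bool.≟ true) ×-dec all? (λ j → encode t ≤? encode (rotation t j))

  representative-minimal : ∀ {t} → length t ≡ p → IsRepresentative t →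
                           ∀ e → encode t ≤ encode (iter rotate e t)
  representative-minimal {t} len (_ , minimal) e = begin
    encode t                        ≤⟨ minimal j ⟩
    encode (iter rotate (toℕ j) t)  ≡⟨ cong (λ k → encode (iter rotate k t)) (toℕ-fromℕ< (m%n<n e p)) ⟩
    encode (iter rotate (e % p) t)  ≡⟨ cong encode (iter-% rotate (iter-rotate-p len) e) ⟨
    encode (iter rotate e t)        ∎
    where
    open ≤-Reasoning
    j = fromℕ< (m%n<n e p)

  module _ {s : List (Fin n)} (len : length s ≡ p) where

    length-rotation : ∀ i → length (rotation s i) ≡ p
    length-rotation i = trans (length-iter-rotate (toℕ i) s) len

    rotate-rotation : ∀ i e → iter rotate e (rotation s i) ≡ rotation s (fromℕ< (m%n<n (e + toℕ i) p))
    rotate-rotation i e = begin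
      iter rotate e (rotation s i)               ≡⟨ iter-+ rotate e (toℕ i) s ⟨
      iter rotate (e + toℕ i) s                  ≡⟨ iter-% rotate (iter-rotate-p len) (e + toℕ i) ⟩
      iter rotate ((e + toℕ i) % p) s            ≡⟨ cong (λ k → iter rotate k s) (toℕ-fromℕ< (m%n<n (e + toℕ i) p)) ⟨
      rotation s (fromℕ< (m%n<n (e + toℕ i) p))  ∎
      where open ≡-Reasoning

    rotation-reachable : ∀ i j → rotation s j ≡ iter rotate (toℕ j + (p ∸ toℕ i)) (rotation s i)
    rotation-reachable i j = begin
      iter rotate b s                           ≡⟨ cong (iter rotate b) (iter-rotate-p len) ⟨
      iter rotate b (iter rotate p s)           ≡⟨ iter-+ rotate b p s ⟨
      iter rotate (b + p) s                     ≡⟨ cong (λ e → iter rotate e s) b+p≡ ⟩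
      iter rotate (b + (p ∸ a) + a) s           ≡⟨ iter-+ rotate (b + (p ∸ a)) a s ⟩
      iter rotate (b + (p ∸ a)) (rotation s i)  ∎
      where
      open ≡-Reasoning
      a = toℕ i
      b = toℕ j
      b+p≡ : b + p ≡ b + (p ∸ a) + a
      b+p≡ = trans (cong (b +_) (sym (m∸n+n≡m (<⇒≤ (toℕ<n i))))) (sym (+-assoc b (p ∸ a) a))

    rotations-distinct : C s ≡ true → ∀ {a b} → a < b → b < p → iter rotate a s ≢ iter rotate b s
    rotations-distinct Cs {a} {b} a<b b<p eq =
      no-proper-period (trans (length-iter-rotate a s) len) (trans (C-iter-rotate a s) Cs)
                       (m<n⇒0<n∸m a<b) (≤-<-trans (m∸n≤m b a) b<p) period
      where
      period : iter rotate (b ∸ a) (iter rotate a s) ≡ iter rotate a s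
      period = trans (sym (iter-+ rotate (b ∸ a) a s))
                     (trans (cong (λ e → iter rotate e s) (m∸n+n≡m (<⇒≤ a<b))) (sym eq))

    rotation-injective : C s ≡ true → ∀ {i j} → rotation s i ≡ rotation s j → i ≡ j
    rotation-injective Cs {i} {j} eq with <-cmp (toℕ i) (toℕ j)
    ... | tri< i<j _ _ = contradiction eq (rotations-distinct Cs i<j (toℕ<n j))
    ... | tri≈ _ i≡j _ = toℕ-injective i≡j
    ... | tri> _ _ j<i = contradiction (sym eq) (rotations-distinct Cs j<i (toℕ<n i))

    representative-exists : C s ≡ true → ∃[ i ] IsRepresentative (rotation s i)
    representative-exists Cs = i₀ , trans (C-iter-rotate (toℕ i₀) s) Cs , minimal
      where
      f : Fin p → ℕ
      f = encode ∘ rotation s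
      i₀ : Fin p
      i₀ = argmin f (fromℕ< (>-nonZero⁻¹ p)) (allFin p)
      minimal : ∀ j → f i₀ ≤ encode (rotation (rotation s i₀) j)
      minimal j = begin
        f i₀                                          ≤⟨ All.lookup (f[argmin]≤f[xs] {f = f} _ (allFin p)) (∈-allFin k) ⟩
        f k                                           ≡⟨ cong encode (rotate-rotation i₀ (toℕ j)) ⟨
        encode (iter rotate (toℕ j) (rotation s i₀))  ∎
        where
        open ≤-Reasoning
        k = fromℕ< (m%n<n (toℕ j + toℕ i₀) p)

    representative-unique : C s ≡ true → ∀ {i j} → IsRepresentative (rotation s i) →
                            IsRepresentative (rotation s j) → i ≡ j
    representative-unique Cs {i} {j} rᵢ rⱼ =
      rotation-injective Cs (encode-injective (trans (length-rotation i) (sym (length-rotation j)))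
                                              (≤-antisym (least {i} {j} rᵢ) (least {j} {i} rⱼ)))
      where
      least : ∀ {a b} → IsRepresentative (rotation s a) → encode (rotation s a) ≤ encode (rotation s b)
      least {a} {b} r = subst (encode (rotation s a) ≤_) (cong encode (sym (rotation-reachable a b)))
                              (representative-minimal (length-rotation a) r (toℕ b + (p ∸ toℕ a)))

  representatives-in-orbit : ∀ s → length s ≡ p →
                             𝟙 (C s) ≡ ∑[ i < p ] 𝟙 (does (isRepresentative? (rotation s i)))
  representatives-in-orbit s len with C s in Cs
  ... | true  = let i , rᵢ = representative-exists len Cs in
    sym (∑-𝟙-unique (isRepresentative? ∘ rotation s) {i} rᵢ (λ r → representative-unique len Cs r rᵢ))
  ... | false = sym (∑-𝟙-none (isRepresentative? ∘ rotation s) λ i (C-rotation , _) →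
    contradiction (trans (sym Cs) (trans (sym (C-iter-rotate (toℕ i) s)) C-rotation)) λ ())

  p∣count : p ∣ sumLists p (𝟙 ∘ C)
  p∣count = subst (p ∣_) (sym counting) (m∣m*n _)
    where
    R : List (Fin n) → ℕ
    R = 𝟙 ∘ does ∘ isRepresentative?
    open ≡-Reasoning
    counting : sumLists p (𝟙 ∘ C) ≡ p * sumLists p R
    counting = begin
      sumLists p (𝟙 ∘ C)                              ≡⟨ sumLists-cong p representatives-in-orbit ⟩
      sumLists p (λ s → ∑[ i < p ] R (rotation s i))  ≡⟨ ∑-sumLists-comm p (λ i s → R (rotation s i)) ⟨
      ∑[ i < p ] sumLists p (λ s → R (rotation s i))  ≡⟨ sum-cong-≗ {p} (λ i → sumLists-iter-rotate p (toℕ i) R) ⟩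
      ∑[ i < p ] sumLists p R                         ≡⟨ ∑-const {p} (sumLists p R) ⟩
      p * sumLists p R                                ∎

-- Walks in a graph

module Walks {n} (G : Graph n) where

  A : Fin n → Fin n → ℕ
  A u v = 𝟙 (adj G u v)

  A-sym : ∀ u v → A u v ≡ A v u
  A-sym u v = cong 𝟙 (Graph.sym G u v)

  adj⇒≢ : ∀ {u v} → adj G u v ≡ true → u ≢ v
  adj⇒≢ {u} uv refl = contradiction (trans (sym uv) (irrefl G u)) λ ()

  degree : Fin n → ℕ
  degree u = ∑[ x < n ] A u x

  walks : ℕ → Fin n → Fin n → ℕ
  walks zero    u v = δ u v
  walks (suc ℓ) u v = ∑[ x < n ] (A u x * walks ℓ x v)

  walks-1 : ∀ u v → walks 1 u v ≡ A u v
  walks-1 u v = trans (sum-cong-≗ λ x → trans (cong (A u x *_) (δ-sym x v)) (*-comm (A u x) (δ v x)))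
                      (∑-δ v (A u))

  walks-2 : ∀ u v → walks 2 u v ≡ commonNbrs G u v
  walks-2 u v = sym (trans (count≡∑ (λ w → adj G u w ∧ adj G v w)) (sum-cong-≗ λ w →
    trans (𝟙-∧ (adj G u w) (adj G v w)) (cong (A u w *_) (sym (trans (walks-1 w v) (A-sym w v))))))

  walks-2-diagonal : ∀ u → walks 2 u u ≡ degree u
  walks-2-diagonal u = sum-cong-≗ λ x →
    trans (cong (A u x *_) (trans (walks-1 x u) (A-sym x u))) (𝟙-idem (adj G u x))

  walks-+ : ∀ ℓ m u v → walks (ℓ + m) u v ≡ ∑[ y < n ] (walks ℓ u y * walks m y v)
  walks-+ zero    m u v = sym (∑-δ u (λ y → walks m y v))
  walks-+ (suc ℓ) m u v = begin
    ∑[ x < n ] (A u x * walks (ℓ + m) x v)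
      ≡⟨ sum-cong-≗ (λ x → cong (A u x *_) (walks-+ ℓ m x v)) ⟩
    ∑[ x < n ] (A u x * ∑[ y < n ] (walks ℓ x y * walks m y v))
      ≡⟨ sum-cong-≗ (λ x → *-distribˡ-sum (A u x) (λ y → walks ℓ x y * walks m y v)) ⟩
    ∑[ x < n ] ∑[ y < n ] (A u x * (walks ℓ x y * walks m y v))
      ≡⟨ ∑-comm (λ x y → A u x * (walks ℓ x y * walks m y v)) ⟩
    ∑[ y < n ] ∑[ x < n ] (A u x * (walks ℓ x y * walks m y v))
      ≡⟨ sum-cong-≗ {n} (λ y → sum-cong-≗ {n} λ x → sym (*-assoc (A u x) _ _)) ⟩
    ∑[ y < n ] ∑[ x < n ] (A u x * walks ℓ x y * walks m y v)
      ≡⟨ sum-cong-≗ (λ y → sym (*-distribʳ-sum (walks m y v) (λ x → A u x * walks ℓ x y))) ⟩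
    ∑[ y < n ] (walks (suc ℓ) u y * walks m y v)
      ∎
    where open ≡-Reasoning

  walks-sym : ∀ ℓ u v → walks ℓ u v ≡ walks ℓ v u
  walks-sym zero    u v = δ-sym u v
  walks-sym (suc ℓ) u v = begin
    ∑[ x < n ] (A u x * walks ℓ x v)        ≡⟨ sum-cong-≗ (λ x → trans (cong₂ _*_ (A≡walks-1 x) (walks-sym ℓ x v))
                                                                   (*-comm (walks 1 x u) _)) ⟩
    ∑[ x < n ] (walks ℓ v x * walks 1 x u)  ≡⟨ walks-+ ℓ 1 v u ⟨
    walks (ℓ + 1) v u                       ≡⟨ cong (λ e → walks e v u) (+-comm ℓ 1) ⟩
    walks (suc ℓ) v u                       ∎
    where
    open ≡-Reasoning
    A≡walks-1 : ∀ x → A u x ≡ walks 1 x u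
    A≡walks-1 x = trans (A-sym u x) (sym (walks-1 x u))

  walks-rowsum : ∀ {k} → (∀ u → degree u ≡ k) → ∀ ℓ u → ∑[ v < n ] walks ℓ u v ≡ k ^ ℓ
  walks-rowsum regular zero    u = trans (sum-cong-≗ λ v → sym (*-identityʳ (δ u v))) (∑-δ u (λ _ → 1))
  walks-rowsum {k} regular (suc ℓ) u = begin
    ∑[ v < n ] ∑[ x < n ] (A u x * walks ℓ x v)  ≡⟨ ∑-comm (λ v x → A u x * walks ℓ x v) ⟩
    ∑[ x < n ] ∑[ v < n ] (A u x * walks ℓ x v)  ≡⟨ sum-cong-≗ (λ x → *-distribˡ-sum (A u x) (walks ℓ x)) ⟨
    ∑[ x < n ] (A u x * ∑[ v < n ] walks ℓ x v)  ≡⟨ sum-cong-≗ (λ x → cong (A u x *_) (walks-rowsum regular ℓ x)) ⟩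
    ∑[ x < n ] (A u x * k ^ ℓ)                   ≡⟨ *-distribʳ-sum (k ^ ℓ) (A u) ⟨
    degree u * k ^ ℓ                             ≡⟨ cong (_* k ^ ℓ) (regular u) ⟩
    k * k ^ ℓ                                    ∎
    where open ≡-Reasoning

  path : Fin n → List (Fin n) → Fin n → Bool
  path a []       b = adj G a b
  path a (x ∷ xs) b = adj G a x ∧ path x xs b

  -- A closed walk of length ℓ is stored as the list of its ℓ vertices, so that rotating
  -- the list gives the same closed walk from another starting vertex.
  closedWalk : List (Fin n) → Bool
  closedWalk []       = false
  closedWalk (x ∷ xs) = path x xs x

  sumLists-path : ∀ m u v → sumLists m (λ xs → 𝟙 (path u xs v)) ≡ walks (suc m) u v
  sumLists-path zero    u v = sym (walks-1 u v)
  sumLists-path (suc m) u v = sum-cong-≗ λ x → begin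
    sumLists m (λ xs → 𝟙 (adj G u x ∧ path x xs v))  ≡⟨ sumLists-cong m (λ xs _ → 𝟙-∧ (adj G u x) (path x xs v)) ⟩
    sumLists m (λ xs → A u x * 𝟙 (path x xs v))      ≡⟨ sumLists-*ˡ m (A u x) (λ xs → 𝟙 (path x xs v)) ⟩
    A u x * sumLists m (λ xs → 𝟙 (path x xs v))      ≡⟨ cong (A u x *_) (sumLists-path m x v) ⟩
    A u x * walks (suc m) x v                        ∎
    where open ≡-Reasoning

  sumLists-closedWalk : ∀ m → sumLists (suc m) (𝟙 ∘ closedWalk) ≡ ∑[ u < n ] walks (suc m) u u
  sumLists-closedWalk m = sum-cong-≗ λ u → sumLists-path m u u

  path-∷ʳ : ∀ a xs x b → path a (xs ∷ʳ x) b ≡ path a xs x ∧ adj G x b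
  path-∷ʳ a []       x b = refl
  path-∷ʳ a (y ∷ ys) x b = trans (cong (adj G a y ∧_) (path-∷ʳ y ys x b)) (sym (∧-assoc (adj G a y) _ _))

  closedWalk-rotate : ∀ s → closedWalk (rotate s) ≡ closedWalk s
  closedWalk-rotate []           = refl
  closedWalk-rotate (x ∷ [])     = refl
  closedWalk-rotate (x ∷ y ∷ ys) = trans (path-∷ʳ y ys x y) (∧-comm (path y ys x) (adj G x y))

  closedWalk-aperiodic : ∀ s → closedWalk s ≡ true → rotate s ≢ s
  closedWalk-aperiodic (x ∷ [])     loop _ = adj⇒≢ loop refl
  closedWalk-aperiodic (x ∷ y ∷ ys) cl fix with ∷-injectiveˡ fix
  ... | refl = adj⇒≢ (∧-conicalˡ _ _ cl) refl

module _ {n} {G : Graph n} {X : Fin n → Bool} where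

  source-not-removed : ∀ {u v} → Walk G X u v → X u ≡ false
  source-not-removed (here Xu)     = Xu
  source-not-removed (step Xu _ _) = Xu

  first-step : ∀ {u v} → Walk G X u v → u ≢ v → ∃[ x ] adj G u x ≡ true × X x ≡ false
  first-step (here _)         u≢u = contradiction refl u≢u
  first-step (step _ ux rest) _   = _ , ux , source-not-removed rest

-- Equivalently: every vertex has degree at least 3.
NeighbourOutsidePairs : ∀ {n} → Graph n → Set
NeighbourOutsidePairs {n} G = ∀ {w u v : Fin n} → w ≢ u → w ≢ v → ∃[ x ] adj G w x ≡ true × x ≢ u × x ≢ v

neighbour-outside-pairs : ∀ {n} {G : Graph n} → ThreeConnected G → NeighbourOutsidePairs G
neighbour-outside-pairs {n} {G} (3<n , connected) {w} {u} {v} w≢u w≢v =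
  let c , Yc       = count<n⇒∃false Y |Y|<n
      x , wx , Xx  = first-step (connected X |X|<3 w c (outside w≢u w≢v) (∨-conicalˡ _ _ Yc))
                                (λ w≡c → dec-false⁻¹ (c ≟ w) (∨-conicalʳ _ _ Yc) (sym w≡c))
  in x , wx , dec-false⁻¹ (x ≟ u) (∨-conicalˡ _ _ Xx) , dec-false⁻¹ (x ≟ v) (∨-conicalʳ _ _ Xx)
  where
  X Y : Fin n → Bool
  X z = does (z ≟ u) ∨ does (z ≟ v)
  Y z = X z ∨ does (z ≟ w)
  |X|≤2 : count X ≤ 2
  |X|≤2 = ≤-trans (count-∨ (λ z → does (z ≟ u)) (λ z → does (z ≟ v)))
                  (≤-reflexive (cong₂ _+_ (count-≟ u) (count-≟ v)))
  |X|<3 : count X < 3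
  |X|<3 = s≤s |X|≤2
  |Y|<n : count Y < n
  |Y|<n = ≤-<-trans (≤-trans (count-∨ X (λ z → does (z ≟ w))) (+-mono-≤ |X|≤2 (≤-reflexive (count-≟ w)))) 3<n
  outside : ∀ {z} → z ≢ u → z ≢ v → X z ≡ false
  outside {z} z≢u z≢v = cong₂ _∨_ (dec-false (z ≟ u) z≢u) (dec-false (z ≟ v) z≢v)

-- Friendship graphs

module Friendship {n} (G : Graph n) (friendship : ∀ {u v} → u ≢ v → commonNbrs G u v ≡ 1) where

  open Walks G

  common-neighbour : ∀ {u v} → u ≢ v → ∃[ w ] adj G u w ≡ true × adj G v w ≡ true
  common-neighbour u≢v =
    let w , uvw = count>0⇒∃ _ (≤-reflexive (sym (friendship u≢v)))
    in w , ∧-conicalˡ _ _ uvw , ∧-conicalʳ _ _ uvw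

  common-neighbour-unique : ∀ {u v w w′} → u ≢ v → adj G u w ≡ true → adj G v w ≡ true →
                            adj G u w′ ≡ true → adj G v w′ ≡ true → w ≡ w′
  common-neighbour-unique u≢v uw vw uw′ vw′ =
    count≤1⇒unique _ (≤-reflexive (friendship u≢v)) (cong₂ _∧_ uw vw) (cong₂ _∧_ uw′ vw′)

  degree≡walks-3 : ∀ {u v} → adj G u v ≡ false → degree u ≡ walks 3 u v
  degree≡walks-3 {u} {v} u≁v = sum-cong-≗ one-walk-per-neighbour
    where
    one-walk-per-neighbour : ∀ x → A u x ≡ A u x * walks 2 x v
    one-walk-per-neighbour x with adj G u x in ux
    ... | false = refl
    ... | true  = sym (trans (+-identityʳ _) (trans (walks-2 x v) (friendship x≢v)))
      where
      x≢v : x ≢ v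
      x≢v refl = contradiction (trans (sym ux) u≁v) λ ()

  degree-nonadjacent : ∀ {u v} → adj G u v ≡ false → degree u ≡ degree v
  degree-nonadjacent {u} {v} u≁v = begin
    degree u     ≡⟨ degree≡walks-3 u≁v ⟩
    walks 3 u v  ≡⟨ walks-sym 3 u v ⟩
    walks 3 v u  ≡⟨ degree≡walks-3 (trans (Graph.sym G v u) u≁v) ⟨
    degree v     ∎
    where open ≡-Reasoning

  not-adjacent-outside-triangle : ∀ {a c w x} → adj G a c ≡ true → adj G w c ≡ true → adj G a w ≡ true →
                                  adj G w x ≡ true → x ≢ c → adj G a x ≡ false
  not-adjacent-outside-triangle {a} {x = x} ac wc aw wx x≢c with adj G a x in ax
  ... | false = refl
  ... | true  = contradiction (sym (common-neighbour-unique (adj⇒≢ aw) ac wc ax wx)) x≢c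

  degree-adjacent : NeighbourOutsidePairs G → ∀ {u v} → adj G u v ≡ true → degree u ≡ degree v
  degree-adjacent outside {u} {v} uv =
    let w , uw , vw        = common-neighbour (adj⇒≢ uv)
        x , wx , x≢u , x≢v = outside (≢-sym (adj⇒≢ uw)) (≢-sym (adj⇒≢ vw))
        u≁x = not-adjacent-outside-triangle uv (trans (Graph.sym G w v) vw) uw wx x≢v
        v≁x = not-adjacent-outside-triangle (trans (Graph.sym G v u) uv) (trans (Graph.sym G w u) uw) vw wx x≢u
    in trans (degree-nonadjacent u≁x) (sym (degree-nonadjacent v≁x))

  degree-constant : NeighbourOutsidePairs G → ∀ u v → degree u ≡ degree v
  degree-constant outside u v with adj G u v in uv
  ... | true  = degree-adjacent outside uv
  ... | false = degree-nonadjacent uv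

  degree-positive : 1 < n → ∀ u → 0 < degree u
  degree-positive 1<n u =
    let v , v≉u    = count<n⇒∃false (λ v → does (v ≟ u)) (subst (_< n) (sym (count-≟ u)) 1<n)
        w , uw , _ = common-neighbour (≢-sym (dec-false⁻¹ (v ≟ u) v≉u))
    in subst (0 <_) (count≡∑ (adj G u)) (count-pos (adj G u) uw)

  regular : NeighbourOutsidePairs G → 1 < n → ∃[ d ] (∀ u → degree u ≡ suc d)
  regular outside 1<n =
    let u₀              = fromℕ< (<-trans z<s 1<n)
        d , 1+d≡degree = m≤n⇒∃[o]m+o≡n (degree-positive 1<n u₀)
    in d , λ u → trans (degree-constant outside u u₀) (sym 1+d≡degree)

module RegularFriendship {n} (G : Graph n) (friendship : ∀ {u v} → u ≢ v → commonNbrs G u v ≡ 1)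
                         (d : ℕ) (regular : ∀ u → Walks.degree G u ≡ suc d) where

  open Walks G

  walks-2-δ : ∀ u y → walks 2 u y ≡ 1 + δ u y * d
  walks-2-δ u y with u ≟ y
  ... | yes refl = trans (walks-2-diagonal u) (trans (regular u) (cong suc (sym (+-identityʳ d))))
  ... | no u≢y   = trans (walks-2 u y) (friendship u≢y)

  walks-2+ : ∀ m u v → walks (2 + m) u v ≡ suc d ^ m + d * walks m u v
  walks-2+ m u v = begin
    walks (2 + m) u v
      ≡⟨ walks-+ 2 m u v ⟩
    ∑[ y < n ] (walks 2 u y * walks m y v)
      ≡⟨ sum-cong-≗ (λ y → trans (cong (_* walks m y v) (walks-2-δ u y)) (expand (δ u y) d (walks m y v))) ⟩
    ∑[ y < n ] (walks m y v + δ u y * (d * walks m y v))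
      ≡⟨ ∑-distrib-+ (λ y → walks m y v) _ ⟩
    ∑[ y < n ] walks m y v + ∑[ y < n ] (δ u y * (d * walks m y v))
      ≡⟨ cong₂ _+_ (trans (sum-cong-≗ λ y → walks-sym m y v) (walks-rowsum regular m v))
                   (∑-δ u (λ y → d * walks m y v)) ⟩
    suc d ^ m + d * walks m u v
      ∎
    where
    open ≡-Reasoning
    expand : ∀ a d w → (1 + a * d) * w ≡ w + a * (d * w)
    expand = solve 3 (λ a d w → (con 1 :+ a :* d) :* w := w :+ a :* (d :* w)) refl

  order : Fin n → n ≡ 1 + d * suc d
  order u = +-cancelʳ-≡ d n (1 + d * suc d) (begin
    n + d                                  ≡⟨ cong₂ _+_ (trans (∑-const {n} 1) (*-identityʳ n)) (∑-δ u (λ _ → d)) ⟨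
    ∑[ y < n ] 1 + ∑[ y < n ] (δ u y * d)  ≡⟨ ∑-distrib-+ (λ _ → 1) (λ y → δ u y * d) ⟨
    ∑[ y < n ] (1 + δ u y * d)             ≡⟨ sum-cong-≗ (walks-2-δ u) ⟨
    ∑[ y < n ] walks 2 u y                 ≡⟨ walks-rowsum regular 2 u ⟩
    suc d ^ 2                              ≡⟨ square d ⟩
    1 + d * suc d + d                      ∎)
    where
    open ≡-Reasoning
    square : ∀ d → suc d ^ 2 ≡ 1 + d * suc d + d
    square = solve 1 (λ d → (con 1 :+ d) :^ 2 := con 1 :+ d :* (con 1 :+ d) :+ d) refl

  closed-walks-% : ∀ {p} .{{_ : NonZero p}} → p ∣ d → ∀ m u → walks (2 + m) u u % p ≡ 1 % p
  closed-walks-% {p} p∣d m u = begin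
    walks (2 + m) u u % p              ≡⟨ cong (_% p) (walks-2+ m u u) ⟩
    (suc d ^ m + d * walks m u u) % p  ≡⟨ %-remove-+ʳ (suc d ^ m) (∣m⇒∣m*n (walks m u u) p∣d) ⟩
    suc d ^ m % p                      ≡⟨ suc-^-% p∣d m ⟩
    1 % p                              ∎
    where open ≡-Reasoning

  no-prime-divisor : ∀ {p} → Prime p → p ∣ d → Fin n → ⊥
  no-prime-divisor {p} p-prime p∣d u with m≤n⇒∃[o]m+o≡n (nonTrivial⇒n>1 p {{prime⇒nonTrivial p-prime}})
  ... | m , refl = 0≢1 (begin
    0                             ≡⟨ n∣m⇒m%n≡0 _ p (subst (p ∣_) (sumLists-closedWalk (suc m)) p∣closed) ⟨
    (∑[ u < n ] walks p u u) % p  ≡⟨ ∑-%-cong (closed-walks-% p∣d m) ⟩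
    (∑[ u < n ] 1) % p            ≡⟨ cong (_% p) (trans (∑-const {n} 1) (*-identityʳ n)) ⟩
    n % p                         ≡⟨ cong (_% p) (order u) ⟩
    (1 + d * suc d) % p           ≡⟨ %-remove-+ʳ 1 (∣m⇒∣m*n (suc d) p∣d) ⟩
    1                             ∎)
    where
    open ≡-Reasoning
    p∣closed : p ∣ sumLists p (𝟙 ∘ closedWalk)
    p∣closed = Necklace.p∣count p-prime closedWalk closedWalk-rotate (λ s _ → closedWalk-aperiodic s)
    0≢1 : 0 ≢ 1
    0≢1 ()

  order≤3 : n ≤ 3
  order≤3 = ≮⇒≥ λ 3<n →
    let u                 = fromℕ< (<-trans z<s 3<n)
        p , p-prime , p∣d = ∃-prime-divisor (3<1+d[1+d]⇒1<d d (subst (3 <_) (order u) 3<n))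
    in no-prime-divisor p-prime p∣d u

lemma3p6 : ∀ {n : ℕ} (G : Graph n) → Polyhedron G → ¬ AIsSingletonOne G
lemma3p6 G (three-connected@(3<n , _) , _) A≡⦃1⦄ =
  let d , regular = Friendship.regular G friendship (neighbour-outside-pairs three-connected)
                                       (≤-trans (s≤s (s≤s z≤n)) 3<n)
  in <⇒≱ 3<n (RegularFriendship.order≤3 G friendship d regular)
  where
  friendship : ∀ {u v} → u ≢ v → commonNbrs G u v ≡ 1
  friendship u≢v = proj₁ (A≡⦃1⦄ _) (_ , _ , u≢v , refl)
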